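{- Let $T$ be a tree with $n\ge 1$ vertices, let $t\ge1$ be an integer, and let $s$ be a $t$-dilated configuration on $T$. Suppose $T_1,T_2$ are subtrees of $T$ with at least one common vertex such that $s$ forms a minimally $t$-dilated configuration on both $T_1$ and $T_2$. Then $s$ forms a minimally $t$-dilated configuration on both $T_1\cap T_2$ and $T_1\cup T_2$.
   Context: Label the vertices $v_1,\dots,v_n$. A chip configuration on $T$ is a vector $s\in\mathbb{Z}_{\ge0}^n$ ($s_i$ chips on $v_i$); the number of chips of $s$ on a subtree is the sum of its entries over the subtree's vertices. A subtree is a nonempty connected subgraph. For $t\ge1$, $s$ is $t$-dilated on a tree $T'$ (with $T'$ a subtree of $T$, considering the restriction of $s$) if $s$ has at least $t(m-1)$ chips on every $m$-vertex subtree of $T'$; it is minimally $t$-dilated on $T'$ if in addition it has exactly $t(|V(T')|-1)$ chips on $T'$. "Forms a minimally $t$-dilated configuration on $T'$" means the restriction of $s$ to $T'$ is minimally $t$-dilated on $T'$. -}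

module Defs where

open import Data.Nat using (ℕ; zero; suc; _+_; _*_; _∸_; _≤_)
open import Data.Fin using (Fin)
open import Data.Fin.Subset using (Subset; _∈_; _⊆_; Nonempty; ∣_∣)
open import Data.Vec using (Vec; lookup; tabulate; foldr)
open import Data.Bool using (Bool; true; false; if_then_else_)
open import Data.List using (List; []; _∷_; length)
open import Data.List.Relation.Unary.Unique.Propositional using (Unique)
open import Data.Product using (Σ; _×_; _,_)
open import Relation.Binary.PropositionalEquality using (_≡_)
open import Relation.Nullary using (¬_)

record Graph (n : ℕ) : Set where
  field
    adj   : Fin n → Fin n → Bool
    sym   : ∀ u v → adj u v ≡ adj v u
    irrefl : ∀ v → adj v v ≡ false
open Graph public

data WalkIn {n} (G : Graph n) (S : Subset n) : Fin n → Fin n → Set where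
  here : ∀ {v} → v ∈ S → WalkIn G S v v
  step : ∀ {u w v} → u ∈ S → adj G u w ≡ true → WalkIn G S w v → WalkIn G S u v

ConnectedOn : ∀ {n} → Graph n → Subset n → Set
ConnectedOn G S = ∀ u v → u ∈ S → v ∈ S → WalkIn G S u v

data AdjChain {n} (G : Graph n) : List (Fin n) → Set where
  nil  : AdjChain G []
  one  : ∀ v → AdjChain G (v ∷ [])
  cons : ∀ u v vs → adj G u v ≡ true → AdjChain G (v ∷ vs) → AdjChain G (u ∷ v ∷ vs)

IsCycle : ∀ {n} → Graph n → List (Fin n) → Set
IsCycle G [] = Data.Empty.⊥ where import Data.Empty
IsCycle G (v ∷ vs) =
  (3 ≤ length (v ∷ vs)) × Unique (v ∷ vs) × AdjChain G (v ∷ vs) × adj G (lastOr v vs) v ≡ true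
  where
  lastOr : Fin _ → List (Fin _) → Fin _
  lastOr x [] = x
  lastOr x (y ∷ ys) = lastOr y ys

Acyclic : ∀ {n} → Graph n → Set
Acyclic G = ∀ c → ¬ IsCycle G c

full : ∀ {n} → Subset n
full = tabulate (λ _ → true)

IsTree : ∀ {n} → Graph n → Set
IsTree G = ConnectedOn G full × Acyclic G

IsSubtree : ∀ {n} → Graph n → Subset n → Set
IsSubtree G S = Nonempty S × ConnectedOn G S

Config : ℕ → Set
Config n = Fin n → ℕ

chips : ∀ {n} → Config n → Subset n → ℕ
chips {n} s S = foldr _ _+_ 0 (tabulate λ i → if lookup S i then s i else 0)

Dilated : ∀ {n} → Graph n → ℕ → Config n → Subset n → Set
Dilated G t s S' = ∀ U → U ⊆ S' → IsSubtree G U → t * (∣ U ∣ ∸ 1) ≤ chips s U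

MinDilated : ∀ {n} → Graph n → ℕ → Config n → Subset n → Set
MinDilated G t s S' = Dilated G t s S' × chips s S' ≡ t * (∣ S' ∣ ∸ 1)

-- In an acyclic graph a simple walk is determined by its endpoints: if two of them leave u
-- towards different neighbours a ≠ b, the rest of both walks joins a to b away from u, and
-- after loop erasure this closes up through u into a cycle. So the path between two vertices
-- of T₁ ∩ T₂ lies in both subtrees, making T₁ ∩ T₂ a subtree; T₁ ∪ T₂ is one through a common
-- vertex. Both chips and t (|·| − 1) are modular on such a pair (the latter since all four sets
-- are nonempty), so chips on T₁ ∪ T₂ and on T₁ ∩ T₂ add up to the sum of their dilation bounds,
-- and each being at least its bound forces equality in both.
module Submission where

open import Defs hiding (sym)

open import Algebra.Properties.CommutativeSemigroup using (interchange)
open import Data.Bool using (Bool; true; false; _∨_; _∧_; if_then_else_)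
open import Data.Empty using (⊥-elim)
open import Data.Fin using (Fin; zero; suc; _≟_)
open import Data.Fin.Subset using (Subset; _∈_; _∉_; _⊆_; _∩_; _∪_; ∁; ⁅_⁆; ∣_∣; Nonempty; inside; outside)
open import Data.Fin.Subset.Properties
  using (x∈p∩q⁺; x∈p∪q⁻; p⊆p∪q; q⊆p∪q; p∩q⊆p; p∩q⊆q; x∈⁅x⁆; x∈⁅y⁆⇒x≡y; x≢y⇒x∉⁅y⁆;
         x∉p⇒x∈∁p; x∈p⇒x∉∁p; p⊆q⇒∣p∣≤∣q∣; ∣⁅x⁆∣≡1)
open import Data.List using (List; []; _∷_; length)
import Data.List.Membership.DecPropositional as DecMembership
open import Data.List.Relation.Unary.All as All using (All; []; _∷_)
open import Data.List.Relation.Unary.All.Properties using (¬Any⇒All¬)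
open import Data.List.Relation.Unary.Any as Any using ()
open import Data.List.Relation.Unary.Unique.Propositional using (Unique; []; _∷_)
open import Data.List.Relation.Unary.Unique.Propositional.Properties using (Unique[x∷xs]⇒x∉xs)
open import Data.Nat using (ℕ; suc; _+_; _*_; _∸_; _≤_; z≤n; s≤s)
open import Data.Nat.Properties
  using (+-commutativeSemigroup; +-comm; +-suc; suc-injective; *-distribˡ-+; ≤-antisym; ≤-trans; ≤-reflexive;
         +-monoˡ-≤; +-monoʳ-≤; +-cancelˡ-≤; +-cancelʳ-≤)
open import Data.Product using (Σ-syntax; _×_; _,_; proj₁; proj₂)
open import Data.Sum using (inj₁; inj₂)
open import Data.Vec using ([]; _∷_)
open import Data.Vec.Properties using (lookup⇒[]=; lookup∘tabulate)
open import Function using (_∘_)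
open import Relation.Binary.PropositionalEquality
  using (_≡_; _≢_; refl; sym; trans; cong; cong₂; subst; module ≡-Reasoning)
open import Relation.Nullary using (¬_; yes; no)

-- The closing edge of IsCycle is stated with a where-bound function that cannot be named.
-- Abstracting over y ∷ ys turns the constraint into a pattern, and the meta cycleLast
-- is solved to exactly that function.
mutual
  cycleLast : ∀ {n} → Graph n → Fin n → List (Fin n) → Fin n → List (Fin n) → Fin n
  cycleLast = _

  isCycle⁺ : ∀ {n} (G : Graph n) v y ys → 3 ≤ length (v ∷ y ∷ ys) → Unique (v ∷ y ∷ ys) →
             AdjChain G (v ∷ y ∷ ys) → adj G (cycleLast G v (y ∷ ys) y ys) v ≡ true →
             IsCycle G (v ∷ y ∷ ys)
  isCycle⁺ G v y ys with y ∷ ys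
  ... | _ = λ long distinct chain closing → long , distinct , chain , closing

module Walks {n : ℕ} (G : Graph n) where

  open DecMembership (_≟_ {n}) using (_∈?_) renaming (_∈_ to _∈ₗ_)

  private variable
    S S′ : Subset n
    u v w a b : Fin n

  adj-sym : adj G u v ≡ true → adj G v u ≡ true
  adj-sym {u} {v} e = trans (Graph.sym G v u) e

  vertices : WalkIn G S u v → List (Fin n)
  vertices (here {v} _)     = v ∷ []
  vertices (step {u} _ _ p) = u ∷ vertices p

  start∈ : WalkIn G S u v → u ∈ S
  start∈ (here u∈)     = u∈
  start∈ (step u∈ _ _) = u∈

  end∈vertices : (p : WalkIn G S u v) → v ∈ₗ vertices p
  end∈vertices (here _)     = Any.here refl
  end∈vertices (step _ _ p) = Any.there (end∈vertices p)

  vertices⊆ : (p : WalkIn G S u v) → All (_∈ S) (vertices p)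
  vertices⊆ (here v∈)     = v∈ ∷ []
  vertices⊆ (step u∈ _ p) = u∈ ∷ vertices⊆ p

  restrict : (p : WalkIn G S u v) → All (_∈ S′) (vertices p) → WalkIn G S′ u v
  restrict (here _)     (v∈ ∷ [])  = here v∈
  restrict (step _ e p) (u∈ ∷ ps∈) = step u∈ e (restrict p ps∈)

  walk-mono : S ⊆ S′ → WalkIn G S u v → WalkIn G S′ u v
  walk-mono S⊆S′ p = restrict p (All.map S⊆S′ (vertices⊆ p))

  adjChain : (p : WalkIn G S u v) → AdjChain G (vertices p)
  adjChain (here _)                  = one _
  adjChain (step _ e (here _))       = cons _ _ _ e (one _)
  adjChain (step _ e p@(step _ _ _)) = cons _ _ _ e (adjChain p)

  cycleLast-vertices : ∀ x W y (p : WalkIn G S a b) → cycleLast G x W y (vertices p) ≡ b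
  cycleLast-vertices x W y (here _)     = refl
  cycleLast-vertices x W y (step _ _ p) = cycleLast-vertices x W _ p

  infixr 5 _◅◅_
  _◅◅_ : WalkIn G S u w → WalkIn G S w v → WalkIn G S u v
  here _       ◅◅ q = q
  step u∈ e p  ◅◅ q = step u∈ e (p ◅◅ q)

  reverse : WalkIn G S u v → WalkIn G S v u
  reverse (here v∈)     = here v∈
  reverse (step u∈ e p) = reverse p ◅◅ step (start∈ p) (adj-sym e) (here u∈)

  suffixFrom : (p : WalkIn G S a b) → Unique (vertices p) → w ∈ₗ vertices p →
               Σ[ q ∈ WalkIn G S w b ] Unique (vertices q)
  suffixFrom p@(here _)     p!       (Any.here refl) = p , p!
  suffixFrom p@(step _ _ _) p!       (Any.here refl) = p , p!
  suffixFrom (step _ _ p)   (_ ∷ p!) (Any.there w∈)  = suffixFrom p p! w∈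

  loop-erase : WalkIn G S u v → Σ[ q ∈ WalkIn G S u v ] Unique (vertices q)
  loop-erase (here u∈) = here u∈ , [] ∷ []
  loop-erase (step {u} u∈ e p) with loop-erase p
  ... | q , q! with u ∈? vertices q
  ...   | yes u∈q = suffixFrom q q! u∈q
  ...   | no  u∉q = step u∈ e q , ¬Any⇒All¬ _ u∉q ∷ q!

  neighbours-disconnected : ∀ {S u a b} → Acyclic G → adj G u a ≡ true → adj G u b ≡ true →
                            a ≢ b → u ∉ S → ¬ WalkIn G S a b
  neighbours-disconnected {S} {u} {a} acyclic ua ub a≢b u∉S p with loop-erase p
  ... | here _ , _ = a≢b refl
  ... | q@(step _ _ q′) , q! =
    acyclic (u ∷ vertices q)
      (isCycle⁺ G u _ (vertices q′) (s≤s (s≤s (nonempty q′)))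
        (All.map (λ x∈S u≡x → u∉S (subst (_∈ S) (sym u≡x) x∈S)) (vertices⊆ q) ∷ q!)
        (cons _ _ _ ua (adjChain q))
        (subst (λ x → adj G x u ≡ true) (sym (cycleLast-vertices u (vertices q) a q′)) (adj-sym ub)))
    where
    nonempty : ∀ {x y} (r : WalkIn G S x y) → 1 ≤ length (vertices r)
    nonempty (here _)     = s≤s z≤n
    nonempty (step _ _ _) = s≤s z≤n

  avoiding : (p : WalkIn G S a b) → All (u ≢_) (vertices p) → WalkIn G (∁ ⁅ u ⁆) a b
  avoiding p u∉p = restrict p (All.map (λ u≢x → x∉p⇒x∈∁p (x≢y⇒x∉⁅y⁆ (u≢x ∘ sym))) u∉p)

  simple-walk-unique : Acyclic G → (p : WalkIn G S u v) (q : WalkIn G S′ u v) →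
                       Unique (vertices p) → Unique (vertices q) → vertices p ≡ vertices q
  simple-walk-unique _ (here _) (here _) _ _ = refl
  simple-walk-unique _ (here _) (step _ _ q) _ q! = ⊥-elim (Unique[x∷xs]⇒x∉xs q! (end∈vertices q))
  simple-walk-unique _ (step _ _ p) (here _) p! _ = ⊥-elim (Unique[x∷xs]⇒x∉xs p! (end∈vertices p))
  simple-walk-unique acyclic (step {u} {a} _ ua p) (step {w = b} _ ub q) (u∉p ∷ p!) (u∉q ∷ q!) with a ≟ b
  ... | yes refl = cong (u ∷_) (simple-walk-unique acyclic p q p! q!)
  ... | no  a≢b  = ⊥-elim (neighbours-disconnected acyclic ua ub a≢b (x∈p⇒x∉∁p (x∈⁅x⁆ u))
                                                    (avoiding p u∉p ◅◅ reverse (avoiding q u∉q)))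

  ∩-connected : Acyclic G → ConnectedOn G S → ConnectedOn G S′ → ConnectedOn G (S ∩ S′)
  ∩-connected {S} {S′} acyclic connected connected′ u v u∈ v∈
    with loop-erase (connected u v (p∩q⊆p S S′ u∈) (p∩q⊆p S S′ v∈))
       | loop-erase (connected′ u v (p∩q⊆q S S′ u∈) (p∩q⊆q S S′ v∈))
  ... | p , p! | q , q! =
    restrict p (All.zipWith x∈p∩q⁺ (vertices⊆ p , subst (All (_∈ S′)) (sym same) (vertices⊆ q)))
    where
    same : vertices p ≡ vertices q
    same = simple-walk-unique acyclic p q p! q!

  ∪-connected : Nonempty (S ∩ S′) → ConnectedOn G S → ConnectedOn G S′ → ConnectedOn G (S ∪ S′)
  ∪-connected {S} {S′} (w , w∈) connected connected′ u v u∈ v∈ = toCommon u∈ ◅◅ reverse (toCommon v∈)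
    where
    toCommon : ∀ {x} → x ∈ S ∪ S′ → WalkIn G (S ∪ S′) x w
    toCommon {x} x∈ with x∈p∪q⁻ S S′ x∈
    ... | inj₁ x∈S  = walk-mono (p⊆p∪q S′) (connected x w x∈S (p∩q⊆p S S′ w∈))
    ... | inj₂ x∈S′ = walk-mono (q⊆p∪q S S′) (connected′ x w x∈S′ (p∩q⊆q S S′ w∈))

open Walks using (∩-connected; ∪-connected)

∈-full : ∀ {n} (x : Fin n) → x ∈ full
∈-full x = lookup⇒[]= x full (lookup∘tabulate _ x)

Dilated-⊆ : ∀ {n} {G : Graph n} {t s} {S S′ : Subset n} → S ⊆ S′ → Dilated G t s S′ → Dilated G t s S
Dilated-⊆ S⊆S′ dilated U U⊆S = dilated U (S⊆S′ ∘ U⊆S)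

if-∨+if-∧ : ∀ (a b : Bool) x →
            (if a ∨ b then x else 0) + (if a ∧ b then x else 0) ≡ (if a then x else 0) + (if b then x else 0)
if-∨+if-∧ true  true  x = refl
if-∨+if-∧ true  false x = refl
if-∨+if-∧ false true  x = +-comm x 0
if-∨+if-∧ false false x = refl

chips-∪+chips-∩ : ∀ {n} (s : Config n) (A B : Subset n) →
                  chips s (A ∪ B) + chips s (A ∩ B) ≡ chips s A + chips s B
chips-∪+chips-∩ s []      []      = refl
chips-∪+chips-∩ s (a ∷ A) (b ∷ B) = begin
  (chip (a ∨ b) + chips s′ (A ∪ B)) + (chip (a ∧ b) + chips s′ (A ∩ B))
    ≡⟨ interchange +-commutativeSemigroup (chip (a ∨ b)) _ (chip (a ∧ b)) _ ⟩
  (chip (a ∨ b) + chip (a ∧ b)) + (chips s′ (A ∪ B) + chips s′ (A ∩ B))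
    ≡⟨ cong₂ _+_ (if-∨+if-∧ a b (s zero)) (chips-∪+chips-∩ s′ A B) ⟩
  (chip a + chip b) + (chips s′ A + chips s′ B)
    ≡⟨ interchange +-commutativeSemigroup (chip a) _ (chips s′ A) _ ⟩
  (chip a + chips s′ A) + (chip b + chips s′ B) ∎
  where
  open ≡-Reasoning
  s′ : Config _
  s′ = s ∘ suc
  chip : Bool → ℕ
  chip x = if x then s zero else 0

∣p∣≡chips1 : ∀ {n} (p : Subset n) → ∣ p ∣ ≡ chips (λ _ → 1) p
∣p∣≡chips1 []            = refl
∣p∣≡chips1 (inside  ∷ p) = cong suc (∣p∣≡chips1 p)
∣p∣≡chips1 (outside ∷ p) = ∣p∣≡chips1 p

∣p∪q∣+∣p∩q∣≡∣p∣+∣q∣ : ∀ {n} (p q : Subset n) → ∣ p ∪ q ∣ + ∣ p ∩ q ∣ ≡ ∣ p ∣ + ∣ q ∣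
∣p∪q∣+∣p∩q∣≡∣p∣+∣q∣ p q = begin
  ∣ p ∪ q ∣ + ∣ p ∩ q ∣               ≡⟨ cong₂ _+_ (∣p∣≡chips1 (p ∪ q)) (∣p∣≡chips1 (p ∩ q)) ⟩
  chips 1s (p ∪ q) + chips 1s (p ∩ q) ≡⟨ chips-∪+chips-∩ 1s p q ⟩
  chips 1s p + chips 1s q             ≡⟨ cong₂ _+_ (∣p∣≡chips1 p) (∣p∣≡chips1 q) ⟨
  ∣ p ∣ + ∣ q ∣                       ∎
  where
  open ≡-Reasoning
  1s : Config _
  1s _ = 1

x∈p⇒1≤∣p∣ : ∀ {n} {p : Subset n} {x} → x ∈ p → 1 ≤ ∣ p ∣
x∈p⇒1≤∣p∣ {p = p} {x} x∈p =
  subst (_≤ ∣ p ∣) (∣⁅x⁆∣≡1 x) (p⊆q⇒∣p∣≤∣q∣ (λ y∈⁅x⁆ → subst (_∈ p) (sym (x∈⁅y⁆⇒x≡y x y∈⁅x⁆)) x∈p))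

*-∸1-+-cong : ∀ t {a b c d} → 1 ≤ a → 1 ≤ b → 1 ≤ c → 1 ≤ d → a + b ≡ c + d →
                t * (a ∸ 1) + t * (b ∸ 1) ≡ t * (c ∸ 1) + t * (d ∸ 1)
*-∸1-+-cong t {suc a} {suc b} {suc c} {suc d} _ _ _ _ sum≡ = begin
  t * a + t * b ≡⟨ *-distribˡ-+ t a b ⟨
  t * (a + b)   ≡⟨ cong (t *_) sum≡′ ⟩
  t * (c + d)   ≡⟨ *-distribˡ-+ t c d ⟩
  t * c + t * d ∎
  where
  open ≡-Reasoning
  sum≡′ : a + b ≡ c + d
  sum≡′ = suc-injective (trans (sym (+-suc a b)) (trans (suc-injective sum≡) (+-suc c d)))

dilation-bound-modular : ∀ {n} t (p q : Subset n) → Nonempty (p ∩ q) →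
  t * (∣ p ∪ q ∣ ∸ 1) + t * (∣ p ∩ q ∣ ∸ 1) ≡ t * (∣ p ∣ ∸ 1) + t * (∣ q ∣ ∸ 1)
dilation-bound-modular t p q (x , x∈p∩q) =
  *-∸1-+-cong t (x∈p⇒1≤∣p∣ (p⊆p∪q q x∈p)) (x∈p⇒1≤∣p∣ x∈p∩q) (x∈p⇒1≤∣p∣ x∈p) (x∈p⇒1≤∣p∣ x∈q)
                (∣p∪q∣+∣p∩q∣≡∣p∣+∣q∣ p q)
  where
  x∈p : x ∈ p
  x∈p = p∩q⊆p p q x∈p∩q
  x∈q : x ∈ q
  x∈q = p∩q⊆q p q x∈p∩q

+-squeeze : ∀ {m n p q} → m + n ≡ p + q → p ≤ m → q ≤ n → m ≡ p × n ≡ q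
+-squeeze {m} {n} {p} {q} sum≡ p≤m q≤n =
  ≤-antisym (+-cancelʳ-≤ n m p (≤-trans (≤-reflexive sum≡) (+-monoʳ-≤ p q≤n))) p≤m ,
  ≤-antisym (+-cancelˡ-≤ m n q (≤-trans (≤-reflexive sum≡) (+-monoˡ-≤ q p≤m))) q≤n

lemma4p4 : ∀ (n : ℕ) → 1 ≤ n → (T : Graph n) → IsTree T →
    (t : ℕ) → 1 ≤ t → (s : Config n) → Dilated T t s full →
    (T₁ T₂ : Subset n) → IsSubtree T T₁ → IsSubtree T T₂ → Nonempty (T₁ ∩ T₂) →
    MinDilated T t s T₁ → MinDilated T t s T₂ →
    MinDilated T t s (T₁ ∩ T₂) × MinDilated T t s (T₁ ∪ T₂)
lemma4p4 n _ T (_ , acyclic) t _ s dilated T₁ T₂ (_ , connected₁) (_ , connected₂) common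
         (_ , tight₁) (_ , tight₂) =
  (dilated-on , proj₂ tight) , (dilated-on , proj₁ tight)
  where
  open ≡-Reasoning
  dilated-on : ∀ {S} → Dilated T t s S
  dilated-on = Dilated-⊆ {t = t} (λ {x} _ → ∈-full x) dilated
  lower-bound : ∀ {U} → IsSubtree T U → t * (∣ U ∣ ∸ 1) ≤ chips s U
  lower-bound subtree = dilated-on _ (λ x∈ → x∈) subtree
  subtree∩ : IsSubtree T (T₁ ∩ T₂)
  subtree∩ = common , ∩-connected T acyclic connected₁ connected₂
  subtree∪ : IsSubtree T (T₁ ∪ T₂)
  subtree∪ = (proj₁ common , p⊆p∪q T₂ (p∩q⊆p T₁ T₂ (proj₂ common))) ,
             ∪-connected T common connected₁ connected₂
  tight : chips s (T₁ ∪ T₂) ≡ t * (∣ T₁ ∪ T₂ ∣ ∸ 1) × chips s (T₁ ∩ T₂) ≡ t * (∣ T₁ ∩ T₂ ∣ ∸ 1)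
  tight = +-squeeze (begin
    chips s (T₁ ∪ T₂) + chips s (T₁ ∩ T₂)         ≡⟨ chips-∪+chips-∩ s T₁ T₂ ⟩
    chips s T₁ + chips s T₂                       ≡⟨ cong₂ _+_ tight₁ tight₂ ⟩
    t * (∣ T₁ ∣ ∸ 1) + t * (∣ T₂ ∣ ∸ 1)             ≡⟨ dilation-bound-modular t T₁ T₂ common ⟨
    t * (∣ T₁ ∪ T₂ ∣ ∸ 1) + t * (∣ T₁ ∩ T₂ ∣ ∸ 1) ∎)
    (lower-bound subtree∪) (lower-bound subtree∩)
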